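{- Let $m,l,h$ be integers with $0\le h<m$, $0<l$, $6\mid m$, and let $a\in\{ -1,1\}$ with $3\mid(l-ah)$. Suppose that either $\sigma(l)=0$ and $\sigma(m)=\sigma(l-ah)+1$, or $\sigma(h)\sigma(l)\neq0$ and $\sigma(m)\le\sigma(l-ah)$. Let $b=\gcd(l-ah,m)$ and $\alpha(l)=(3+(-1)^l)/2$. Then for every choice of $t_0,\dots,t_{b/(3\alpha(l))-1}\in\{0,1\}$, the set $\bigcup_{r=0}^{b/(3\alpha(l))-1}C^{a}(r,t_r)$ is a perfect code of $\Gamma'_{m,l,h}$, where $C^{a}(r,t_r)=\{\psi(3r+aj+(j+t_r)m/2,\ j) : j\in\mathbb{Z}\}$.
   Context: $\hat{x}$ is the least nonnegative integer representative of a residue class $x$. $\Gamma_{m,l,h}$ is the graph with vertex set $\mathbb{Z}_m\times\mathbb{Z}_l$ whose edges are $\{(a,b),(a+1,b)\}$ for all $a,b$; $\{(a,c),(a,c+1)\}$ for all $a$ and all $c$ with $\hat c\neq l-1$; and $\{(a,-1),(a-h,0)\}$ for all $a\in\mathbb{Z}_m$. $\Gamma'_{m,l,h}$ is the graph on $\mathbb{Z}_m\times\mathbb{Z}_l$ in which $(a,b),(a',b')$ are adjacent iff they are adjacent in $\Gamma_{m,l,h}$, or $a'=a+m/2$ and $b=b'$. For integers $i,J$, $\psi(i,J)=(i-\lfloor J/l\rfloor h\bmod m,\ J\bmod l)$. A perfect code is a vertex set $C$ such that every vertex is at distance at most $1$ from exactly one vertex of $C$. $\sigma(n)$ is the largest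 nonnegative integer $i$ with $2^i\mid n$ ($\sigma(0)=+\infty$). -}

module Defs where

open import Data.Nat as ℕ using (ℕ; zero; suc; NonZero)
open import Data.Nat.DivMod using (_mod_)
open import Data.Fin using (Fin; toℕ)
open import Data.Integer as ℤ using (ℤ; +_; _+_; _-_; _*_; -_; _/ℕ_; _%ℕ_; ∣_∣)
open import Data.Integer.Divisibility as ℤD using ()
open import Data.Product using (_×_; _,_; ∃; ∃!)
open import Data.Sum using (_⊎_)
open import Relation.Binary.PropositionalEquality using (_≡_; _≢_)

data ℕ∞ : Set where
  fin : ℕ → ℕ∞
  ∞   : ℕ∞

infix 4 _≤∞_
data _≤∞_ : ℕ∞ → ℕ∞ → Set where
  fin≤fin : ∀ {i j} → i ℕ.≤ j → fin i ≤∞ fin j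
  ≤∞-top  : ∀ {x} → x ≤∞ ∞

suc∞ : ℕ∞ → ℕ∞
suc∞ (fin i) = fin (suc i)
suc∞ ∞       = ∞

-- σ(n) = s : s is the largest nonnegative i with 2^i ∣ n, and σ(0) = +∞.
-- Given as the graph of the (total) function σ.
IsSigma : ℤ → ℕ∞ → Set
IsSigma n (fin i) = (+ (2 ℕ.^ i) ℤD.∣ n) × (∀ j → + (2 ℕ.^ j) ℤD.∣ n → j ℕ.≤ i)
IsSigma n ∞       = n ≡ + 0

_≡_[mod_] : ℤ → ℤ → ℕ → Set
x ≡ y [mod n ] = + n ℤD.∣ (x - y)

module Graph (m l h : ℕ) where

  Vertex : Set
  Vertex = Fin m × Fin l

  zx : Fin m → ℤ
  zx x = + toℕ x

  data Edge : Vertex → Vertex → Set where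
    horiz : ∀ {x x' y} → zx x' ≡ zx x + + 1 [mod m ] → Edge (x , y) (x' , y)
    vert  : ∀ {x y y'} → toℕ y ≢ l ℕ.∸ 1 → toℕ y' ≡ suc (toℕ y) → Edge (x , y) (x , y')
    wrap  : ∀ {x x' y y'} → toℕ y ≡ l ℕ.∸ 1 → toℕ y' ≡ 0 →
            zx x' ≡ zx x - + h [mod m ] → Edge (x , y) (x' , y')

  AdjΓ : Vertex → Vertex → Set
  AdjΓ u v = Edge u v ⊎ Edge v u

  AdjΓ' : Vertex → Vertex → Set
  AdjΓ' (x , y) (x' , y') =
    AdjΓ (x , y) (x' , y') ⊎ ((zx x' ≡ zx x + + (m ℕ./ 2) [mod m ]) × y ≡ y')

  WithinOne' : Vertex → Vertex → Set
  WithinOne' v c = v ≡ c ⊎ AdjΓ' v c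

  IsPerfectCode' : (Vertex → Set) → Set
  IsPerfectCode' C = ∀ v → ∃! _≡_ (λ c → C c × WithinOne' v c)

  ψ : .{{_ : NonZero m}} .{{_ : NonZero l}} → ℤ → ℤ → Vertex
  ψ i J = (((i - (J /ℕ l) * + h) %ℕ m) mod m) , ((J %ℕ l) mod l)

-- α(l) = (3 + (-1)^l)/2, i.e. 2 for even l and 1 for odd l.
-- Written as α l = suc (α-1 l) so that 3 * α l is visibly nonzero.
α-1 : ℕ → ℕ
α-1 zero          = 1
α-1 (suc zero)    = 0
α-1 (suc (suc n)) = α-1 n

α : ℕ → ℕ
α l = suc (α-1 l)

module Submission where

open import Defs
open import Data.Nat as ℕ using (ℕ; NonZero; _<_; _/_)
open import Data.Nat.GCD using (gcd)
open import Data.Nat.Divisibility using (_∣_)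
open import Data.Integer as ℤ using (ℤ; +_; _+_; _-_; _*_; -_; ∣_∣)
open import Data.Integer.Divisibility as ℤD using ()
open import Data.Fin using (Fin; toℕ)
open import Data.Product using (_×_; _,_; ∃)
open import Data.Sum using (_⊎_)
open import Relation.Binary.PropositionalEquality using (_≡_; _≢_)

open import Data.Empty using (⊥-elim)
open import Data.Fin using (fromℕ<)
import Data.Fin.Properties as FP
open import Data.Integer using (+[1+_]; -[1+_]; _/ℕ_; _%ℕ_)
open import Data.Integer.DivMod using (a≡a%ℕn+[a/ℕn]*n; n%ℕd<d)
import Data.Integer.Divisibility.Signed as S
import Data.Integer.Properties as ℤP
open import Data.Integer.Tactic.RingSolver using (solve; solve-∀)
open import Data.List using ([]; _∷_)
open import Data.Nat using (zero; suc; _^_)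
open import Data.Nat.Divisibility using (divides)
import Data.Nat.Divisibility as ℕD
open import Data.Nat.DivMod using (_mod_; m<n⇒m%n≡m; m*[n/m]≡n)
open import Data.Nat.GCD using (gcd-GCD; gcd-greatest; gcd[m,n]∣m; gcd[m,n]∣n; gcd[m,n]≢0; module Bézout)
open import Data.Nat.Primality using (euclidsLemma; prime[2])
import Data.Nat.Properties as ℕP
import Data.Nat.Tactic.RingSolver as NS
open import Data.Product using (∃₂; ∃!; proj₁; proj₂; uncurry)
open import Data.Sum using (inj₁; inj₂; [_,_]′)
import Data.Sum as Sum
open import Function using (case_of_)
open import Relation.Binary.PropositionalEquality
  using (refl; sym; trans; cong; cong₂; subst; subst₂; module ≡-Reasoning)
open import Relation.Nullary using (¬_; yes; no)
open ≡-Reasoning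


-- Put M = m/2, g = a·l − h + l·M and L = gℤ + mℤ.  The value i − a·J − J·M modulo L does not
-- depend on the preimage (i, J) of a vertex under ψ, so it is an invariant of vertices; the
-- codewords of index r are exactly the vertices whose invariant is 3r + t_r·M.  Walking to one of
-- the six vertices at distance at most 1 lowers the invariant by δ + e·M, where (δ, e) runs once
-- through {0, ±1} × {0, 1}.  So C is a perfect code as soon as every integer is, modulo L, uniquely
-- of the form 3r + t_r·M + δ + e·M.  This holds if D = 3R divides g and M, lies in gℤ + Mℤ, and
-- M ∉ L: then Dℤ = L ∪ (M + L), while the residues 3r + δ cover ℤ/Dℤ exactly once.  The 2-adic
-- hypotheses provide these conditions for D = gcd(l − ah, m)/α(l), the gcd of l − ah and M.

-- Euclidean division and congruences

i+j-j≡i : ∀ i j → i + j - j ≡ i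
i+j-j≡i = solve-∀

i-[i+j]≡-j : ∀ i j → i - (i + j) ≡ - j
i-[i+j]≡-j = solve-∀

positive-multiple-overshoots : ∀ ρ ρ′ d n → ρ′ < d → + ρ + +[1+ n ] * + d ≢ + ρ′
positive-multiple-overshoots ρ ρ′ d n ρ′<d eq = ℕP.<⇒≱ ρ′<d (subst (d ℕ.≤_) eq′ d≤lhs)
  where
  eq′ : ρ ℕ.+ suc n ℕ.* d ≡ ρ′
  eq′ = ℤP.+-injective (begin
    + (ρ ℕ.+ suc n ℕ.* d)       ≡⟨ ℤP.pos-+ ρ (suc n ℕ.* d) ⟩
    + ρ + + (suc n ℕ.* d)       ≡⟨ cong (λ x → + ρ + x) (ℤP.pos-* (suc n) d) ⟩
    + ρ + +[1+ n ] * + d        ≡⟨ eq ⟩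
    + ρ′                        ∎)
  d≤lhs : d ℕ.≤ ρ ℕ.+ suc n ℕ.* d
  d≤lhs = ℕP.≤-trans (ℕP.m≤m+n d (n ℕ.* d)) (ℕP.m≤n+m (suc n ℕ.* d) ρ)

residue-shift≡0 : ∀ {ρ ρ′ d} k → ρ < d → ρ′ < d → + ρ + k * + d ≡ + ρ′ → k ≡ + 0
residue-shift≡0 (+ zero)   _   _    _  = refl
residue-shift≡0 +[1+ n ]   _   ρ′<d eq = ⊥-elim (positive-multiple-overshoots _ _ _ n ρ′<d eq)
residue-shift≡0 {ρ} {ρ′} {d} -[1+ n ] ρ<d _ eq =
  ⊥-elim (positive-multiple-overshoots ρ′ ρ d n ρ<d (begin
    + ρ′ + +[1+ n ] * + d                        ≡⟨ cong (_+ +[1+ n ] * + d) eq ⟨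
    + ρ + -[1+ n ] * + d + +[1+ n ] * + d       ≡⟨ cancel (+ ρ) +[1+ n ] (+ d) ⟩
    + ρ                                          ∎))
  where
  cancel : ∀ x k d → x + (- k) * d + k * d ≡ x
  cancel = solve-∀

/ℕ-%ℕ-unique : ∀ z q ρ d .{{_ : NonZero d}} → ρ < d → z ≡ + ρ + q * + d →
               z /ℕ d ≡ q × z %ℕ d ≡ ρ
/ℕ-%ℕ-unique z q ρ d ρ<d z≡ = ℤP.i-j≡0⇒i≡j q₀ q k≡0 , ρ₀≡ρ
  where
  q₀ = z /ℕ d
  ρ₀ = z %ℕ d
  shift : + ρ₀ + (q₀ - q) * + d ≡ + ρ
  shift = begin
    + ρ₀ + (q₀ - q) * + d            ≡⟨ regroup (+ ρ₀) q₀ q (+ d) ⟩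
    (+ ρ₀ + q₀ * + d) - q * + d      ≡⟨ cong (_- q * + d) (trans (sym (a≡a%ℕn+[a/ℕn]*n z d)) z≡) ⟩
    (+ ρ + q * + d) - q * + d        ≡⟨ i+j-j≡i (+ ρ) (q * + d) ⟩
    + ρ                              ∎
    where
    regroup : ∀ r a b d → r + (a - b) * d ≡ (r + a * d) - b * d
    regroup = solve-∀
  k≡0 : q₀ - q ≡ + 0
  k≡0 = residue-shift≡0 (q₀ - q) (n%ℕd<d z d) ρ<d shift
  ρ₀≡ρ : ρ₀ ≡ ρ
  ρ₀≡ρ = ℤP.+-injective (begin
    + ρ₀                      ≡⟨ ℤP.+-identityʳ (+ ρ₀) ⟨
    + ρ₀ + + 0 * + d          ≡⟨ cong (λ k → + ρ₀ + k * + d) k≡0 ⟨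
    + ρ₀ + (q₀ - q) * + d     ≡⟨ shift ⟩
    + ρ                       ∎)

i-j≡k⇒i≡j+k : ∀ i j {k} → i - j ≡ k → i ≡ j + k
i-j≡k⇒i≡j+k i j refl = solve (i ∷ j ∷ [])

i-j≡k⇒j≡i-k : ∀ i j {k} → i - j ≡ k → j ≡ i - k
i-j≡k⇒j≡i-k i j {k} eq with i-j≡k⇒i≡j+k i j eq
... | refl = solve (j ∷ k ∷ [])

residues-∣-difference⇒≡ : ∀ {ρ₁ ρ₂} D → ρ₁ < D → ρ₂ < D →
                          + D S.∣ (+ ρ₁ - + ρ₂) → ρ₁ ≡ ρ₂
residues-∣-difference⇒≡ {ρ₁} {ρ₂} D ρ₁<D ρ₂<D (S.divides k eq) = begin
  ρ₁             ≡⟨ proj₂ (/ℕ-%ℕ-unique (+ ρ₁) (+ 0) ρ₁ D ρ₁<D ρ₁≡ρ₁+0) ⟨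
  + ρ₁ %ℕ D      ≡⟨ proj₂ (/ℕ-%ℕ-unique (+ ρ₁) k ρ₂ D ρ₂<D ρ₁≡ρ₂+kD) ⟩
  ρ₂             ∎
  where
  instance
    D≢0 : NonZero D
    D≢0 = ℕ.>-nonZero (ℕP.≤-<-trans ℕ.z≤n ρ₁<D)
  ρ₁≡ρ₁+0 : + ρ₁ ≡ + ρ₁ + + 0 * + D
  ρ₁≡ρ₁+0 = sym (trans (cong (λ x → + ρ₁ + x) (ℤP.*-zeroˡ (+ D))) (ℤP.+-identityʳ (+ ρ₁)))
  ρ₁≡ρ₂+kD : + ρ₁ ≡ + ρ₂ + k * + D
  ρ₁≡ρ₂+kD = i-j≡k⇒i≡j+k (+ ρ₁) (+ ρ₂) eq

toℕ-%ℕ-mod : ∀ z n .{{_ : NonZero n}} → toℕ ((z %ℕ n) mod n) ≡ z %ℕ n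
toℕ-%ℕ-mod z n = trans (FP.toℕ-fromℕ< _) (m<n⇒m%n≡m (n%ℕd<d z n))

%ℕ-≡[mod] : ∀ z n .{{_ : NonZero n}} → (+ (z %ℕ n)) ≡ z [mod n ]
%ℕ-≡[mod] z n = S.∣⇒∣ᵤ (S.divides (- (z /ℕ n)) (begin
  + (z %ℕ n) - z                            ≡⟨ cong (λ w → + (z %ℕ n) - w) (a≡a%ℕn+[a/ℕn]*n z n) ⟩
  + (z %ℕ n) - (+ (z %ℕ n) + z /ℕ n * + n)  ≡⟨ i-[i+j]≡-j (+ (z %ℕ n)) (z /ℕ n * + n) ⟩
  - (z /ℕ n * + n)                          ≡⟨ ℤP.neg-distribˡ-* (z /ℕ n) (+ n) ⟩
  - (z /ℕ n) * + n                          ∎))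

≡[mod]⇒%ℕ-mod≡ : ∀ n .{{_ : NonZero n}} (x : Fin n) z →
                 (+ toℕ x) ≡ z [mod n ] → (z %ℕ n) mod n ≡ x
≡[mod]⇒%ℕ-mod≡ n x z x≡z with S.divides k eq ← S.∣ᵤ⇒∣ x≡z = FP.toℕ-injective (begin
  toℕ ((z %ℕ n) mod n)   ≡⟨ toℕ-%ℕ-mod z n ⟩
  z %ℕ n                 ≡⟨ proj₂ (/ℕ-%ℕ-unique z (- k) (toℕ x) n (FP.toℕ<n x) z≡) ⟩
  toℕ x                  ∎)
  where
  z≡ : z ≡ + toℕ x + (- k) * + n
  z≡ = trans (i-j≡k⇒j≡i-k (+ toℕ x) z eq) (cong (λ y → + toℕ x + y) (ℤP.neg-distribˡ-* k (+ n)))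

Digit : ℤ → Set
Digit δ = δ ≡ + 0 ⊎ δ ≡ + 1 ⊎ δ ≡ - + 1

Bit : ℤ → Set
Bit e = e ≡ + 0 ⊎ e ≡ + 1

digit-decomposition : ∀ w → ∃₂ λ δ W → Digit δ × w ≡ δ + W * + 3
digit-decomposition w with w %ℕ 3 | n%ℕd<d w 3 | a≡a%ℕn+[a/ℕn]*n w 3
... | 0 | _ | eq = + 0 , w /ℕ 3 , inj₁ refl , eq
... | 1 | _ | eq = + 1 , w /ℕ 3 , inj₂ (inj₁ refl) , eq
... | 2 | _ | eq = - + 1 , w /ℕ 3 + + 1 , inj₂ (inj₂ refl) , trans eq (carry (w /ℕ 3))
  where
  carry : ∀ W → + 2 + W * + 3 ≡ - + 1 + (W + + 1) * + 3
  carry = solve-∀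
... | suc (suc (suc _)) | ℕ.s≤s (ℕ.s≤s (ℕ.s≤s ())) | _

bit-decomposition : ∀ w → ∃₂ λ e W → Bit e × w ≡ e + W * + 2
bit-decomposition w = + (w %ℕ 2) , w /ℕ 2 , bit (w %ℕ 2) (n%ℕd<d w 2) , a≡a%ℕn+[a/ℕn]*n w 2
  where
  bit : ∀ ρ → ρ < 2 → Bit (+ ρ)
  bit 0 _ = inj₁ refl
  bit 1 _ = inj₂ refl
  bit (suc (suc _)) (ℕ.s≤s (ℕ.s≤s ()))

3∤1 : ¬ (+ 3 S.∣ + 1)
3∤1 3∣1 with ℕ.s≤s () ← ℕD.∣⇒≤ (S.∣⇒∣ᵤ 3∣1)

3∤2 : ¬ (+ 3 S.∣ + 2)
3∤2 3∣2 with ℕ.s≤s (ℕ.s≤s ()) ← ℕD.∣⇒≤ (S.∣⇒∣ᵤ 3∣2)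

Digit-∣-difference⇒≡ : ∀ {δ₁ δ₂} → Digit δ₁ → Digit δ₂ → + 3 S.∣ (δ₁ - δ₂) → δ₁ ≡ δ₂
Digit-∣-difference⇒≡ (inj₁ refl)        (inj₁ refl)        _ = refl
Digit-∣-difference⇒≡ (inj₂ (inj₁ refl)) (inj₂ (inj₁ refl)) _ = refl
Digit-∣-difference⇒≡ (inj₂ (inj₂ refl)) (inj₂ (inj₂ refl)) _ = refl
Digit-∣-difference⇒≡ (inj₁ refl)        (inj₂ (inj₁ refl)) p = ⊥-elim (3∤1 (S.∣m⇒∣-m p))
Digit-∣-difference⇒≡ (inj₁ refl)        (inj₂ (inj₂ refl)) p = ⊥-elim (3∤1 p)
Digit-∣-difference⇒≡ (inj₂ (inj₁ refl)) (inj₁ refl)        p = ⊥-elim (3∤1 p)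
Digit-∣-difference⇒≡ (inj₂ (inj₁ refl)) (inj₂ (inj₂ refl)) p = ⊥-elim (3∤2 p)
Digit-∣-difference⇒≡ (inj₂ (inj₂ refl)) (inj₁ refl)        p = ⊥-elim (3∤1 (S.∣m⇒∣-m p))
Digit-∣-difference⇒≡ (inj₂ (inj₂ refl)) (inj₂ (inj₁ refl)) p = ⊥-elim (3∤2 (S.∣m⇒∣-m p))

≡[mod]-reflexive : ∀ {a b} n → a ≡ b → a ≡ b [mod n ]
≡[mod]-reflexive {a} n refl = subst (λ z → n ℕD.∣ ∣ z ∣) (sym (ℤP.+-inverseʳ a)) (n ℕD.∣0)

≡[mod]-move : ∀ n a b c → a ≡ b + c [mod n ] → b ≡ a - c [mod n ]
≡[mod]-move n a b c =
  subst (n ℕD.∣_) (trans (sym (ℤP.∣-i∣≡∣i∣ (a - (b + c)))) (cong ∣_∣ (negate a b c)))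
  where
  negate : ∀ a b c → - (a - (b + c)) ≡ b - (a - c)
  negate = solve-∀

-- Tiling ℤ by the lattice gℤ + mℤ

module Lattice (g m : ℤ) where

  InLattice : ℤ → Set
  InLattice z = ∃₂ λ k q → z ≡ k * g + q * m

  InLattice-0 : InLattice (+ 0)
  InLattice-0 = + 0 , + 0 , solve (g ∷ m ∷ [])

  InLattice-neg : ∀ {z} → InLattice z → InLattice (- z)
  InLattice-neg (k , q , refl) = - k , - q , solve (k ∷ q ∷ g ∷ m ∷ [])

  InLattice-+ : ∀ {z z′} → InLattice z → InLattice z′ → InLattice (z + z′)
  InLattice-+ (k , q , refl) (k′ , q′ , refl) =
    k + k′ , q + q′ , solve (k ∷ q ∷ k′ ∷ q′ ∷ g ∷ m ∷ [])

  InLattice⇒∣ : ∀ {d z} → d S.∣ g → d S.∣ m → InLattice z → d S.∣ z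
  InLattice⇒∣ d∣g d∣m (k , q , refl) = S.∣m∣n⇒∣m+n (S.∣n⇒∣m*n k d∣g) (S.∣n⇒∣m*n q d∣m)

  infix 4 _∼_
  record _∼_ (x y : ℤ) : Set where
    constructor mk∼
    field difference : InLattice (x - y)

  ∼-reflexive : ∀ {x y} → x ≡ y → x ∼ y
  ∼-reflexive {x} refl = mk∼ (subst InLattice (sym (ℤP.+-inverseʳ x)) InLattice-0)

  ∼-sym : ∀ {x y} → x ∼ y → y ∼ x
  ∼-sym {x} {y} (mk∼ p) = mk∼ (subst InLattice { - (x - y)} {y - x} (solve (x ∷ y ∷ [])) (InLattice-neg p))

  ∼-trans : ∀ {x y z} → x ∼ y → y ∼ z → x ∼ z
  ∼-trans {x} {y} {z} (mk∼ p) (mk∼ q) =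
    mk∼ (subst InLattice {(x - y) + (y - z)} {x - z} (solve (x ∷ y ∷ z ∷ [])) (InLattice-+ p q))

  m∼0 : m ∼ + 0
  m∼0 = mk∼ (+ 0 , + 1 , solve (g ∷ m ∷ []))

  ∼-+-congʳ : ∀ {x y} c → x ∼ y → x + c ∼ y + c
  ∼-+-congʳ {x} {y} c (mk∼ p) =
    mk∼ (subst InLattice {x - y} {x + c - (y + c)} (solve (x ∷ y ∷ c ∷ [])) p)

  ∼-+-cancelʳ : ∀ c {x y} → x + c ∼ y + c → x ∼ y
  ∼-+-cancelʳ c {x} {y} (mk∼ p) =
    mk∼ (subst InLattice {x + c - (y + c)} {x - y} (solve (c ∷ x ∷ y ∷ [])) p)

  ∼-+-congˡ : ∀ c {x y} → x ∼ y → c + x ∼ c + y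
  ∼-+-congˡ c {x} {y} (mk∼ p) =
    mk∼ (subst InLattice {x - y} {c + x - (c + y)} (solve (c ∷ x ∷ y ∷ [])) p)

record TilingConditions (g M m : ℤ) (R : ℕ) : Set where
  field
    {{R≢0}}  : NonZero R
    D∣g      : + (3 ℕ.* R) S.∣ g
    D∣M      : + (3 ℕ.* R) S.∣ M
    x y      : ℤ
    D≡xg+yM  : + (3 ℕ.* R) ≡ x * g + y * M
    M∉L      : ¬ Lattice.InLattice g m M

module Tiling (g M m : ℤ) (m≡2M : m ≡ + 2 * M) {R : ℕ} (conditions : TilingConditions g M m R)
              (τ : Fin R → ℤ) where

  open TilingConditions conditions
  open Lattice g m

  D : ℕ
  D = 3 ℕ.* R

  s : Fin R → ℤ
  s r = + 3 * + toℕ r + τ r * M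

  private
    representation : ∀ {w} x y ρ Q R̂ τᵣ δ e Y → + 3 * R̂ ≡ x * g + y * M →
      w ≡ δ + (ρ + Q * R̂) * + 3 → Q * y - τᵣ ≡ e + Y * + 2 →
      w - (+ 3 * ρ + τᵣ * M + δ + e * M) ≡ (Q * x) * g + Y * m
    representation x y ρ Q R̂ τᵣ δ e Y 3R̂≡ refl Y≡ = begin
      δ + (ρ + Q * R̂) * + 3 - (+ 3 * ρ + τᵣ * M + δ + e * M)
        ≡⟨ solve (ρ ∷ Q ∷ R̂ ∷ τᵣ ∷ δ ∷ e ∷ M ∷ []) ⟩
      Q * (+ 3 * R̂) - (τᵣ + e) * M
        ≡⟨ cong (λ z → Q * z - (τᵣ + e) * M) 3R̂≡ ⟩
      Q * (x * g + y * M) - (τᵣ + e) * M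
        ≡⟨ solve (Q ∷ x ∷ g ∷ y ∷ M ∷ τᵣ ∷ e ∷ []) ⟩
      (Q * x) * g + (Q * y - τᵣ - e) * M
        ≡⟨ cong (λ z → (Q * x) * g + (z - e) * M) Y≡ ⟩
      (Q * x) * g + (e + Y * + 2 - e) * M
        ≡⟨ solve (Q ∷ x ∷ g ∷ e ∷ Y ∷ M ∷ []) ⟩
      (Q * x) * g + Y * (+ 2 * M)
        ≡⟨ cong (λ z → (Q * x) * g + Y * z) m≡2M ⟨
      (Q * x) * g + Y * m
        ∎

  tiling-exists : ∀ w → ∃ λ r → ∃₂ λ δ e → Digit δ × Bit e × w ∼ s r + δ + e * M
  tiling-exists w with digit-decomposition w
  ... | δ , W , δ-digit , w≡ with bit-decomposition (W /ℕ R * y - τ (fromℕ< (n%ℕd<d W R)))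
  ... | e , Y , e-bit , Y≡ = r , δ , e , δ-digit , e-bit , mk∼ (W /ℕ R * x , Y , difference)
    where
    r : Fin R
    r = fromℕ< (n%ℕd<d W R)
    W≡ : W ≡ + toℕ r + W /ℕ R * + R
    W≡ = trans (a≡a%ℕn+[a/ℕn]*n W R) (cong (λ ρ → + ρ + W /ℕ R * + R) (sym (FP.toℕ-fromℕ< _)))
    difference : w - (s r + δ + e * M) ≡ (W /ℕ R * x) * g + Y * m
    difference = representation x y (+ toℕ r) (W /ℕ R) (+ R) (τ r) δ e Y
                   (trans (sym (ℤP.pos-* 3 R)) D≡xg+yM) (trans w≡ (cong (λ z → δ + z * + 3) W≡)) Y≡

  private
    3∣D : + 3 S.∣ + D
    3∣D = S.divides (+ R) (trans (ℤP.pos-* 3 R) (ℤP.*-comm (+ 3) (+ R)))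

    ∼⇒D∣ : ∀ {u v} → u ∼ v → + D S.∣ (u - v)
    ∼⇒D∣ (mk∼ p) = InLattice⇒∣ D∣g (subst (+ D S.∣_) (sym m≡2M) (S.∣n⇒∣m*n (+ 2) D∣M)) p

    separate-digits : ∀ ρ₁ ρ₂ τ₁ τ₂ δ₁ δ₂ e₁ e₂ →
      (+ 3 * ρ₁ + τ₁ * M + δ₁ + e₁ * M) - (+ 3 * ρ₂ + τ₂ * M + δ₂ + e₂ * M)
        ≡ (δ₁ - δ₂) + ((+ 3 * ρ₁ - + 3 * ρ₂) + (τ₁ - τ₂ + e₁ - e₂) * M)
    separate-digits ρ₁ ρ₂ τ₁ τ₂ δ₁ δ₂ e₁ e₂ =
      solve (ρ₁ ∷ ρ₂ ∷ τ₁ ∷ τ₂ ∷ δ₁ ∷ δ₂ ∷ e₁ ∷ e₂ ∷ M ∷ [])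

    separate-offsets : ∀ ρ₁ ρ₂ τ₁ τ₂ δ e₁ e₂ →
      (+ 3 * ρ₁ + τ₁ * M + δ + e₁ * M) - (+ 3 * ρ₂ + τ₂ * M + δ + e₂ * M)
        ≡ (+ 3 * ρ₁ - + 3 * ρ₂) + (τ₁ - τ₂ + e₁ - e₂) * M
    separate-offsets ρ₁ ρ₂ τ₁ τ₂ δ e₁ e₂ =
      solve (ρ₁ ∷ ρ₂ ∷ τ₁ ∷ τ₂ ∷ δ ∷ e₁ ∷ e₂ ∷ M ∷ [])

    X+M∼X⇒M∈L : ∀ X → X + + 1 * M ∼ X + + 0 * M → InLattice M
    X+M∼X⇒M∈L X (mk∼ p) = subst InLattice {X + + 1 * M - (X + + 0 * M)} {M} (solve (X ∷ M ∷ [])) p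

  digits-agree : ∀ r₁ r₂ δ₁ δ₂ e₁ e₂ → Digit δ₁ → Digit δ₂ →
                 s r₁ + δ₁ + e₁ * M ∼ s r₂ + δ₂ + e₂ * M → δ₁ ≡ δ₂
  digits-agree r₁ r₂ δ₁ δ₂ e₁ e₂ d₁ d₂ p =
    Digit-∣-difference⇒≡ d₁ d₂ (S.∣m+n∣n⇒∣m 3∣sum 3∣rest)
    where
    ρ₁ = + toℕ r₁
    ρ₂ = + toℕ r₂
    rest = (+ 3 * ρ₁ - + 3 * ρ₂) + (τ r₁ - τ r₂ + e₁ - e₂) * M
    3∣sum : + 3 S.∣ (δ₁ - δ₂) + rest
    3∣sum = subst (+ 3 S.∣_) (separate-digits ρ₁ ρ₂ (τ r₁) (τ r₂) δ₁ δ₂ e₁ e₂) (S.∣-trans 3∣D (∼⇒D∣ p))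
    3∣rest : + 3 S.∣ rest
    3∣rest = S.∣m∣n⇒∣m+n (S.∣m∣n⇒∣m-n (S.∣m⇒∣m*n ρ₁ S.∣-refl) (S.∣m⇒∣m*n ρ₂ S.∣-refl))
                         (S.∣n⇒∣m*n (τ r₁ - τ r₂ + e₁ - e₂) (S.∣-trans 3∣D D∣M))

  offsets-agree : ∀ r₁ r₂ δ e₁ e₂ → s r₁ + δ + e₁ * M ∼ s r₂ + δ + e₂ * M → r₁ ≡ r₂
  offsets-agree r₁ r₂ δ e₁ e₂ p =
    FP.toℕ-injective (ℕP.*-cancelˡ-≡ (toℕ r₁) (toℕ r₂) 3
      (residues-∣-difference⇒≡ D (3r<D r₁) (3r<D r₂) (subst (+ D S.∣_) 3r₁-3r₂≡ D∣3r₁-3r₂)))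
    where
    3r<D : ∀ r → 3 ℕ.* toℕ r < D
    3r<D r = ℕP.*-monoʳ-< 3 (FP.toℕ<n r)
    D∣sum : + D S.∣ (+ 3 * + toℕ r₁ - + 3 * + toℕ r₂) + (τ r₁ - τ r₂ + e₁ - e₂) * M
    D∣sum = subst (+ D S.∣_) (separate-offsets (+ toℕ r₁) (+ toℕ r₂) (τ r₁) (τ r₂) δ e₁ e₂)
                  (∼⇒D∣ p)
    D∣3r₁-3r₂ : + D S.∣ + 3 * + toℕ r₁ - + 3 * + toℕ r₂
    D∣3r₁-3r₂ = S.∣m+n∣n⇒∣m D∣sum (S.∣n⇒∣m*n (τ r₁ - τ r₂ + e₁ - e₂) D∣M)
    3r₁-3r₂≡ : + 3 * + toℕ r₁ - + 3 * + toℕ r₂ ≡ + (3 ℕ.* toℕ r₁) - + (3 ℕ.* toℕ r₂)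
    3r₁-3r₂≡ = sym (cong₂ _-_ (ℤP.pos-* 3 (toℕ r₁)) (ℤP.pos-* 3 (toℕ r₂)))

  bits-agree : ∀ X e₁ e₂ → Bit e₁ → Bit e₂ → X + e₁ * M ∼ X + e₂ * M → e₁ ≡ e₂
  bits-agree _ _ _ (inj₁ refl) (inj₁ refl) _ = refl
  bits-agree _ _ _ (inj₂ refl) (inj₂ refl) _ = refl
  bits-agree X _ _ (inj₂ refl) (inj₁ refl) p = ⊥-elim (M∉L (X+M∼X⇒M∈L X p))
  bits-agree X _ _ (inj₁ refl) (inj₂ refl) p = ⊥-elim (M∉L (X+M∼X⇒M∈L X (∼-sym p)))

  tiling-unique : ∀ r₁ r₂ δ₁ δ₂ e₁ e₂ → Digit δ₁ → Digit δ₂ → Bit e₁ → Bit e₂ →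
                  s r₁ + δ₁ + e₁ * M ∼ s r₂ + δ₂ + e₂ * M →
                  r₁ ≡ r₂ × δ₁ ≡ δ₂ × e₁ ≡ e₂
  tiling-unique r₁ r₂ δ₁ δ₂ e₁ e₂ d₁ d₂ b₁ b₂ p =
    r₁≡r₂ , δ₁≡δ₂ , bits-agree (s r₁ + δ₁) e₁ e₂ b₁ b₂ p″
    where
    δ₁≡δ₂ = digits-agree r₁ r₂ δ₁ δ₂ e₁ e₂ d₁ d₂ p
    p′ : s r₁ + δ₁ + e₁ * M ∼ s r₂ + δ₁ + e₂ * M
    p′ = subst (λ δ → s r₁ + δ₁ + e₁ * M ∼ s r₂ + δ + e₂ * M) (sym δ₁≡δ₂) p
    r₁≡r₂ = offsets-agree r₁ r₂ δ₁ e₁ e₂ p′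
    p″ : s r₁ + δ₁ + e₁ * M ∼ s r₁ + δ₁ + e₂ * M
    p″ = subst (λ r → s r₁ + δ₁ + e₁ * M ∼ s r + δ₁ + e₂ * M) (sym r₁≡r₂) p′

-- Closed neighbourhoods in Γ' and the perfect code

+[1+n]≡+n+1 : ∀ n → + suc n ≡ + n + + 1
+[1+n]≡+n+1 n = trans (cong +_ (ℕP.+-comm 1 n)) (ℤP.pos-+ n 1)

i+1≡j⇒i-1*j≡-1 : ∀ i {j} → i + + 1 ≡ j → i + - + 1 * j ≡ - + 1
i+1≡j⇒i-1*j≡-1 i refl = solve (i ∷ [])

i-j≡i+0-1*j : ∀ i j → i - j ≡ i + + 0 - + 1 * j
i-j≡i+0-1*j = solve-∀

i--j≡i+0-[-1]*j : ∀ i j → i - - j ≡ i + + 0 - - + 1 * j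
i--j≡i+0-[-1]*j = solve-∀

i+0-[-1]*j≡i+j : ∀ i j → i + + 0 - - + 1 * j ≡ i + j
i+0-[-1]*j≡i+j = solve-∀

i+0*j≡i : ∀ i j → i + + 0 * j ≡ i
i+0*j≡i = solve-∀

i-0*j≡i : ∀ i j → i - + 0 * j ≡ i
i-0*j≡i = solve-∀

module Neighbourhood (m l h : ℕ) .{{_ : NonZero m}} .{{_ : NonZero l}} where
  open Graph m l h public

  ψ-intro : ∀ i J q {x y} → J ≡ + toℕ y + q * + l → zx x ≡ i - q * + h [mod m ] → ψ i J ≡ (x , y)
  ψ-intro i J q {x} {y} J≡ x≡ = cong₂ _,_ first second
    where
    quotient-remainder = /ℕ-%ℕ-unique J q (toℕ y) l (FP.toℕ<n y) J≡
    first : ((i - J /ℕ l * + h) %ℕ m) mod m ≡ x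
    first = trans (cong (λ k → ((i - k * + h) %ℕ m) mod m) (proj₁ quotient-remainder))
                  (≡[mod]⇒%ℕ-mod≡ m x (i - q * + h) x≡)
    second : (J %ℕ l) mod l ≡ y
    second = FP.toℕ-injective (trans (toℕ-%ℕ-mod J l) (proj₂ quotient-remainder))

  ψ-elim : ∀ i J q ρ → ρ < l → J ≡ + ρ + q * + l →
           toℕ (proj₂ (ψ i J)) ≡ ρ × (zx (proj₁ (ψ i J)) ≡ i - q * + h [mod m ])
  ψ-elim i J q ρ ρ<l J≡ with refl , J%l≡ρ ← /ℕ-%ℕ-unique J q ρ l ρ<l J≡ =
    trans (toℕ-%ℕ-mod J l) J%l≡ρ ,
    subst (λ z → (+ z) ≡ i′ [mod m ]) (sym (toℕ-%ℕ-mod i′ m)) (%ℕ-≡[mod] i′ m)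
    where
    i′ = i - J /ℕ l * + h

  ψ-intro₀ : ∀ i J {x y} → J ≡ + toℕ y → zx x ≡ i [mod m ] → ψ i J ≡ (x , y)
  ψ-intro₀ i J {x} {y} J≡ x≡ =
    ψ-intro i J (+ 0) (trans J≡ (sym (i+0*j≡i (+ toℕ y) (+ l))))
      (subst (λ k → zx x ≡ k [mod m ]) (sym (i-0*j≡i i (+ h))) x≡)

  ψ-elim₀ : ∀ i J ρ → ρ < l → J ≡ + ρ →
            toℕ (proj₂ (ψ i J)) ≡ ρ × (zx (proj₁ (ψ i J)) ≡ i [mod m ])
  ψ-elim₀ i J ρ ρ<l J≡ with y≡ρ , x≡ ← ψ-elim i J (+ 0) ρ ρ<l (trans J≡ (sym (i+0*j≡i (+ ρ) (+ l)))) =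
    y≡ρ , subst (λ k → zx (proj₁ (ψ i J)) ≡ k [mod m ]) (i-0*j≡i i (+ h)) x≡

  Fin-≡[mod]⇒≡ : ∀ {x x′ : Fin m} → zx x ≡ zx x′ [mod m ] → x ≡ x′
  Fin-≡[mod]⇒≡ {x} {x′} x≡x′ =
    FP.toℕ-injective (residues-∣-difference⇒≡ m (FP.toℕ<n x) (FP.toℕ<n x′) (S.∣ᵤ⇒∣ x≡x′))

  data Step : Set where
    stay right left across up down : Step

  Δx : Step → ℤ
  Δx right  = + 1
  Δx left   = - + 1
  Δx across = + (m / 2)
  Δx _      = + 0

  Δy : Step → ℤ
  Δy up   = + 1
  Δy down = - + 1
  Δy _    = + 0

  step : Vertex → Step → Vertex
  step (x , y) σ = ψ (zx x + Δx σ) (+ toℕ y + Δy σ)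

  private
    1+last≡l : suc (l ℕ.∸ 1) ≡ l
    1+last≡l = ℕP.m+[n∸m]≡n (ℕ.>-nonZero⁻¹ l)

    last<l : l ℕ.∸ 1 < l
    last<l = ℕP.≤-reflexive 1+last≡l

    last+1≡l : + (l ℕ.∸ 1) + + 1 ≡ + l
    last+1≡l = trans (sym (+[1+n]≡+n+1 (l ℕ.∸ 1))) (cong +_ 1+last≡l)

    x≡x+0 : ∀ x → x ≡ x + + 0 [mod m ]
    x≡x+0 x = ≡[mod]-reflexive m (sym (ℤP.+-identityʳ x))

    step-up : ∀ {ρ ρ′} → ρ′ ≡ suc ρ → + ρ + + 1 ≡ + ρ′
    step-up {ρ} refl = sym (+[1+n]≡+n+1 ρ)

    step-down : ∀ {ρ ρ′} → ρ ≡ suc ρ′ → + ρ + - + 1 ≡ + ρ′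
    step-down {ρ′ = ρ′} refl = trans (cong (_+ - + 1) (+[1+n]≡+n+1 ρ′)) (i+j-j≡i (+ ρ′) (+ 1))

    wrap-up : ∀ {ρ ρ′} → ρ ≡ l ℕ.∸ 1 → ρ′ ≡ 0 → + ρ + + 1 ≡ + ρ′ + + 1 * + l
    wrap-up refl refl = begin
      + (l ℕ.∸ 1) + + 1     ≡⟨ last+1≡l ⟩
      + l                   ≡⟨ ℤP.*-identityˡ (+ l) ⟨
      + 1 * + l             ≡⟨ ℤP.+-identityˡ (+ 1 * + l) ⟨
      + 0 + + 1 * + l       ∎

    wrap-down : ∀ {ρ ρ′} → ρ ≡ 0 → ρ′ ≡ l ℕ.∸ 1 → + ρ + - + 1 ≡ + ρ′ + - + 1 * + l
    wrap-down refl refl = sym (i+1≡j⇒i-1*j≡-1 (+ (l ℕ.∸ 1)) last+1≡l)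

  withinOne⇒step : ∀ v c → WithinOne' v c → ∃ λ σ → c ≡ step v σ
  withinOne⇒step (x , y) _ (inj₁ refl) =
    stay , sym (ψ-intro₀ (zx x + + 0) (+ toℕ y + + 0) (ℤP.+-identityʳ _) (x≡x+0 (zx x)))
  withinOne⇒step (x , y) _ (inj₂ (inj₁ (inj₁ (horiz x′≡x+1)))) =
    right , sym (ψ-intro₀ (zx x + + 1) (+ toℕ y + + 0) (ℤP.+-identityʳ _) x′≡x+1)
  withinOne⇒step (x , y) _ (inj₂ (inj₁ (inj₂ (horiz {x = x′} x≡x′+1)))) =
    left , sym (ψ-intro₀ (zx x - + 1) (+ toℕ y + + 0) (ℤP.+-identityʳ _)
                 (≡[mod]-move m (zx x) (zx x′) (+ 1) x≡x′+1))
  withinOne⇒step (x , y) _ (inj₂ (inj₁ (inj₁ (vert _ y′≡y+1)))) =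
    up , sym (ψ-intro₀ (zx x + + 0) (+ toℕ y + + 1) (step-up y′≡y+1) (x≡x+0 (zx x)))
  withinOne⇒step (x , y) _ (inj₂ (inj₁ (inj₁ (wrap {x' = x′} y≡last y′≡0 x′≡x-h)))) =
    up , sym (ψ-intro (zx x + + 0) (+ toℕ y + + 1) (+ 1) (wrap-up y≡last y′≡0)
               (subst (λ k → zx x′ ≡ k [mod m ]) (i-j≡i+0-1*j (zx x) (+ h)) x′≡x-h))
  withinOne⇒step (x , y) _ (inj₂ (inj₁ (inj₂ (vert {y = y′} _ y≡y′+1)))) =
    down , sym (ψ-intro₀ (zx x + + 0) (+ toℕ y - + 1) (step-down y≡y′+1) (x≡x+0 (zx x)))
  withinOne⇒step (x , y) _ (inj₂ (inj₁ (inj₂ (wrap {x = x′} y′≡last y≡0 x≡x′-h)))) =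
    down , sym (ψ-intro (zx x + + 0) (+ toℕ y - + 1) (- + 1) (wrap-down y≡0 y′≡last)
                 (subst (λ k → zx x′ ≡ k [mod m ]) (i--j≡i+0-[-1]*j (zx x) (+ h))
                   (≡[mod]-move m (zx x) (zx x′) (- + h) x≡x′-h)))
  withinOne⇒step (x , y) _ (inj₂ (inj₂ (x′≡x+M , refl))) =
    across , sym (ψ-intro₀ (zx x + + (m / 2)) (+ toℕ y + + 0) (ℤP.+-identityʳ _) x′≡x+M)

  private
    horizontal : ∀ {x y x′ y′} → toℕ y′ ≡ toℕ y → zx x′ ≡ zx x + + 1 [mod m ] →
                 WithinOne' (x , y) (x′ , y′)
    horizontal y′≡y p with refl ← FP.toℕ-injective y′≡y = inj₂ (inj₁ (inj₁ (horiz p)))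

    horizontal⁻ : ∀ {x y x′ y′} → toℕ y′ ≡ toℕ y → zx x′ ≡ zx x - + 1 [mod m ] →
                  WithinOne' (x , y) (x′ , y′)
    horizontal⁻ {x} {x′ = x′} y′≡y p with refl ← FP.toℕ-injective y′≡y =
      inj₂ (inj₁ (inj₂ (horiz (≡[mod]-move m (zx x′) (zx x) (- + 1) p))))

    antipodal : ∀ {x y x′ y′} → toℕ y′ ≡ toℕ y → zx x′ ≡ zx x + + (m / 2) [mod m ] →
                WithinOne' (x , y) (x′ , y′)
    antipodal y′≡y p with refl ← FP.toℕ-injective y′≡y = inj₂ (inj₂ (p , refl))

    vertical : ∀ {x y x′ y′} → toℕ y ≢ l ℕ.∸ 1 → toℕ y′ ≡ suc (toℕ y) →
               zx x′ ≡ zx x + + 0 [mod m ] → WithinOne' (x , y) (x′ , y′)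
    vertical {x} {x′ = x′} y≢last y′≡y+1 p
      with refl ← Fin-≡[mod]⇒≡ {x′} {x} (subst (λ k → zx x′ ≡ k [mod m ]) (ℤP.+-identityʳ (zx x)) p) =
      inj₂ (inj₁ (inj₁ (vert y≢last y′≡y+1)))

    vertical⁻ : ∀ {x y x′ y′} → toℕ y ≢ 0 → toℕ y′ ≡ ℕ.pred (toℕ y) →
                zx x′ ≡ zx x + + 0 [mod m ] → WithinOne' (x , y) (x′ , y′)
    vertical⁻ {x} {y} {x′} {y′} y≢0 y′≡y-1 p
      with refl ← Fin-≡[mod]⇒≡ {x′} {x} (subst (λ k → zx x′ ≡ k [mod m ]) (ℤP.+-identityʳ (zx x)) p) =
      inj₂ (inj₁ (inj₂ (vert y′≢last y≡y′+1)))
      where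
      y≡y′+1 : toℕ y ≡ suc (toℕ y′)
      y≡y′+1 = trans (sym (ℕP.suc-pred (toℕ y) {{ℕ.≢-nonZero y≢0}})) (cong suc (sym y′≡y-1))
      y′≢last : toℕ y′ ≢ l ℕ.∸ 1
      y′≢last y′≡last = ℕP.<-irrefl (trans y≡y′+1 (trans (cong suc y′≡last) 1+last≡l)) (FP.toℕ<n y)

    wrapping : ∀ {x y x′ y′} → toℕ y ≡ l ℕ.∸ 1 → toℕ y′ ≡ 0 →
               zx x′ ≡ zx x + + 0 - + 1 * + h [mod m ] → WithinOne' (x , y) (x′ , y′)
    wrapping {x} {x′ = x′} y≡last y′≡0 p = inj₂ (inj₁ (inj₁ (wrap y≡last y′≡0
      (subst (λ k → zx x′ ≡ k [mod m ]) (sym (i-j≡i+0-1*j (zx x) (+ h))) p))))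

    wrapping⁻ : ∀ {x y x′ y′} → toℕ y ≡ 0 → toℕ y′ ≡ l ℕ.∸ 1 →
                zx x′ ≡ zx x + + 0 - - + 1 * + h [mod m ] → WithinOne' (x , y) (x′ , y′)
    wrapping⁻ {x} {x′ = x′} y≡0 y′≡last p = inj₂ (inj₁ (inj₂ (wrap y′≡last y≡0
      (≡[mod]-move m (zx x′) (zx x) (+ h)
        (subst (λ k → zx x′ ≡ k [mod m ]) (i+0-[-1]*j≡i+j (zx x) (+ h)) p)))))

  step-withinOne : ∀ v σ → WithinOne' v (step v σ)
  step-withinOne (x , y) stay =
    inj₁ (sym (ψ-intro₀ (zx x + + 0) (+ toℕ y + + 0) (ℤP.+-identityʳ _) (x≡x+0 (zx x))))
  step-withinOne (x , y) right =
    uncurry horizontal (ψ-elim₀ (zx x + + 1) (+ toℕ y + + 0) (toℕ y) (FP.toℕ<n y) (ℤP.+-identityʳ _))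
  step-withinOne (x , y) left =
    uncurry horizontal⁻ (ψ-elim₀ (zx x - + 1) (+ toℕ y + + 0) (toℕ y) (FP.toℕ<n y) (ℤP.+-identityʳ _))
  step-withinOne (x , y) across =
    uncurry antipodal (ψ-elim₀ (zx x + + (m / 2)) (+ toℕ y + + 0) (toℕ y) (FP.toℕ<n y) (ℤP.+-identityʳ _))
  step-withinOne (x , y) up with toℕ y ℕ.≟ l ℕ.∸ 1
  ... | no y≢last =
    uncurry (vertical y≢last) (ψ-elim₀ (zx x + + 0) (+ toℕ y + + 1) (suc (toℕ y)) y+1<l (step-up refl))
    where
    y+1<l : suc (toℕ y) < l
    y+1<l = ℕP.≤∧≢⇒< (FP.toℕ<n y) (λ y+1≡l → y≢last (cong ℕ.pred y+1≡l))
  ... | yes y≡last =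
    uncurry (wrapping y≡last) (ψ-elim (zx x + + 0) (+ toℕ y + + 1) (+ 1) 0 (ℕ.>-nonZero⁻¹ l) (wrap-up y≡last refl))
  step-withinOne (x , y) down with toℕ y ℕ.≟ 0
  ... | yes y≡0 =
    uncurry (wrapping⁻ y≡0) (ψ-elim (zx x + + 0) (+ toℕ y - + 1) (- + 1) (l ℕ.∸ 1) last<l (wrap-down y≡0 refl))
  ... | no y≢0 =
    uncurry (vertical⁻ y≢0) (ψ-elim₀ (zx x + + 0) (+ toℕ y - + 1) (ℕ.pred (toℕ y)) y-1<l (step-down y≡y-1+1))
    where
    y≡y-1+1 : toℕ y ≡ suc (ℕ.pred (toℕ y))
    y≡y-1+1 = sym (ℕP.suc-pred (toℕ y) {{ℕ.≢-nonZero y≢0}})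
    y-1<l : ℕ.pred (toℕ y) < l
    y-1<l = ℕP.<-trans (ℕP.n<1+n _) (subst (_< l) y≡y-1+1 (FP.toℕ<n y))

inv-shift : ∀ X Y i J Q K a l h M m → J ≡ Y + Q * l → X - (i - Q * h) ≡ K * m →
            (X - a * Y - Y * M) - (i - a * J - J * M) ≡ Q * (a * l - h + l * M) + K * m
inv-shift X Y i _ Q K a l h M m refl X-i≡Km = begin
  (X - a * Y - Y * M) - (i - a * (Y + Q * l) - (Y + Q * l) * M)
    ≡⟨ solve (X ∷ Y ∷ i ∷ Q ∷ a ∷ l ∷ h ∷ M ∷ []) ⟩
  (X - (i - Q * h)) + Q * (a * l - h + l * M)
    ≡⟨ cong (_+ Q * (a * l - h + l * M)) X-i≡Km ⟩
  K * m + Q * (a * l - h + l * M)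
    ≡⟨ ℤP.+-comm (K * m) _ ⟩
  Q * (a * l - h + l * M) + K * m
    ∎

inv-+ : ∀ X Y u v a M → (X + u) - a * (Y + v) - (Y + v) * M ≡ (X - a * Y - Y * M) + (u - a * v - v * M)
inv-+ = solve-∀

inv-codeword-shape : ∀ ρ t j a M → (+ 3 * ρ + a * j + (j + t) * M) - a * j - j * M ≡ + 3 * ρ + t * M
inv-codeword-shape = solve-∀

codeword-congruence : ∀ X Y ρ t k q a l h M m →
  (X - a * Y - Y * M) - (+ 3 * ρ + t * M) ≡ k * (a * l - h + l * M) + q * m →
  X - ((+ 3 * ρ + a * (Y + k * l) + (Y + k * l + t) * M) - k * h) ≡ q * m
codeword-congruence X Y ρ t k q a l h M m eq = begin
  X - ((+ 3 * ρ + a * (Y + k * l) + (Y + k * l + t) * M) - k * h)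
    ≡⟨ solve (X ∷ Y ∷ ρ ∷ t ∷ k ∷ q ∷ a ∷ l ∷ h ∷ M ∷ m ∷ []) ⟩
  ((X - a * Y - Y * M) - (+ 3 * ρ + t * M)) - k * (a * l - h + l * M)
    ≡⟨ cong (_- k * (a * l - h + l * M)) eq ⟩
  k * (a * l - h + l * M) + q * m - k * (a * l - h + l * M)
    ≡⟨ solve (k ∷ q ∷ a ∷ l ∷ h ∷ M ∷ m ∷ []) ⟩
  q * m
    ∎

module Invariant (m l h : ℕ) .{{_ : NonZero m}} .{{_ : NonZero l}} (a : ℤ) where
  open Neighbourhood m l h public

  M : ℤ
  M = + (m / 2)

  g : ℤ
  g = a * + l - + h + + l * M

  open Lattice g (+ m) public

  inv : ℤ → ℤ → ℤ
  inv i J = i - a * J - J * M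

  vinv : Vertex → ℤ
  vinv (x , y) = inv (zx x) (+ toℕ y)

  inv-ψ : ∀ i J → vinv (ψ i J) ∼ inv i J
  inv-ψ i J with y≡J%l , x≡ ← ψ-elim i J (J /ℕ l) (J %ℕ l) (n%ℕd<d J l) (a≡a%ℕn+[a/ℕn]*n J l)
              with S.divides K x-i≡Km ← S.∣ᵤ⇒∣ x≡ =
    mk∼ (J /ℕ l , K , inv-shift X Y i J (J /ℕ l) K a (+ l) (+ h) M (+ m) J≡Y+[J/l]l x-i≡Km)
    where
    X = zx (proj₁ (ψ i J))
    Y = + toℕ (proj₂ (ψ i J))
    J≡Y+[J/l]l : J ≡ Y + J /ℕ l * + l
    J≡Y+[J/l]l = trans (a≡a%ℕn+[a/ℕn]*n J l) (cong (λ ρ → + ρ + J /ℕ l * + l) (sym y≡J%l))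

  Δinv : Step → ℤ
  Δinv σ = Δx σ - a * Δy σ - Δy σ * M

  vinv-step : ∀ v σ → vinv (step v σ) ∼ vinv v + Δinv σ
  vinv-step (x , y) σ = ∼-trans (inv-ψ (zx x + Δx σ) (+ toℕ y + Δy σ))
                                (∼-reflexive (inv-+ (zx x) (+ toℕ y) (Δx σ) (Δy σ) a M))

  δ : Step → ℤ
  δ stay   = + 0
  δ right  = - + 1
  δ left   = + 1
  δ across = + 0
  δ up     = a
  δ down   = - a

  e : Step → ℤ
  e stay  = + 0
  e right = + 0
  e left  = + 0
  e _     = + 1

  private
    stay-digits : ∀ a M → (+ 0 - a * + 0 - + 0 * M) + (+ 0 + + 0 * M) ≡ + 0
    stay-digits = solve-∀
    right-digits : ∀ a M → (+ 1 - a * + 0 - + 0 * M) + (- + 1 + + 0 * M) ≡ + 0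
    right-digits = solve-∀
    left-digits : ∀ a M → (- + 1 - a * + 0 - + 0 * M) + (+ 1 + + 0 * M) ≡ + 0
    left-digits = solve-∀
    across-digits : ∀ a M → (M - a * + 0 - + 0 * M) + (+ 0 + + 1 * M) ≡ + 2 * M
    across-digits = solve-∀
    up-digits : ∀ a M → (+ 0 - a * + 1 - + 1 * M) + (a + + 1 * M) ≡ + 0
    up-digits = solve-∀
    down-digits : ∀ a M → (+ 0 - a * - + 1 - - + 1 * M) + (- a + + 1 * M) ≡ + 2 * M
    down-digits = solve-∀

  module _ (m≡2M : + m ≡ + 2 * M) where

    Δinv-digits : ∀ σ → Δinv σ + (δ σ + e σ * M) ∼ + 0
    Δinv-digits stay   = ∼-reflexive (stay-digits a M)
    Δinv-digits right  = ∼-reflexive (right-digits a M)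
    Δinv-digits left   = ∼-reflexive (left-digits a M)
    Δinv-digits across = ∼-trans (∼-reflexive (trans (across-digits a M) (sym m≡2M))) m∼0
    Δinv-digits up     = ∼-reflexive (up-digits a M)
    Δinv-digits down   = ∼-trans (∼-reflexive (trans (down-digits a M) (sym m≡2M))) m∼0

    vinv-step-digits : ∀ v σ → vinv (step v σ) + (δ σ + e σ * M) ∼ vinv v
    vinv-step-digits v σ =
      ∼-trans (∼-+-congʳ (δ σ + e σ * M) (vinv-step v σ)) (∼-trans
        (∼-reflexive (ℤP.+-assoc (vinv v) (Δinv σ) (δ σ + e σ * M))) (∼-trans
        (∼-+-congˡ (vinv v) (Δinv-digits σ))
        (∼-reflexive (ℤP.+-identityʳ (vinv v)))))

  module Code {R : ℕ} (τ : Fin R → ℤ) where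

    codeword : Fin R → ℤ → ℤ
    codeword r j = + 3 * + toℕ r + a * j + (j + τ r) * M

    Code : Vertex → Set
    Code c = ∃ λ r → ∃ λ (j : ℤ) → c ≡ ψ (codeword r j) j

    s : Fin R → ℤ
    s r = + 3 * + toℕ r + τ r * M

    Code⇒ : ∀ {c} → Code c → ∃ λ r → vinv c ∼ s r
    Code⇒ (r , j , refl) =
      r , ∼-trans (inv-ψ (codeword r j) j) (∼-reflexive (inv-codeword-shape (+ toℕ r) (τ r) j a M))

    ⇒Code : ∀ c r → vinv c ∼ s r → Code c
    ⇒Code (x , y) r (mk∼ (k , q , vinv-s≡kg+qm)) =
      r , J , sym (ψ-intro (codeword r J) J k refl (S.∣⇒∣ᵤ (S.divides q x≡codeword-kh)))
      where
      J = + toℕ y + k * + l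
      x≡codeword-kh =
        codeword-congruence (zx x) (+ toℕ y) (+ toℕ r) (τ r) k q a (+ l) (+ h) M (+ m) vinv-s≡kg+qm

module PerfectCode (m l h : ℕ) .{{_ : NonZero m}} .{{_ : NonZero l}}
                   (a : ℤ) (a≡±1 : a ≡ + 1 ⊎ a ≡ - + 1) (m≡2M : + m ≡ + 2 * + (m / 2))
                   {R : ℕ} (conditions : TilingConditions (Invariant.g m l h a) (+ (m / 2)) (+ m) R)
                   (τ : Fin R → ℤ) where

  open Invariant m l h a
  open Code τ
  open Tiling g M (+ m) m≡2M conditions τ using (tiling-exists; tiling-unique)

  a≢0 : a ≢ + 0
  a≢0 a≡0 = [ (λ a≡1 → case trans (sym a≡0) a≡1 of λ ())
            , (λ a≡-1 → case trans (sym a≡0) a≡-1 of λ ()) ]′ a≡±1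

  a≢-a : a ≢ - a
  a≢-a a≡-a = [ (λ a≡1 → case trans (sym a≡1) (trans a≡-a (cong -_ a≡1)) of λ ())
              , (λ a≡-1 → case trans (sym a≡-1) (trans a≡-a (cong -_ a≡-1)) of λ ()) ]′ a≡±1

  digits-valid : ∀ σ → Digit (δ σ) × Bit (e σ)
  digits-valid stay   = inj₁ refl , inj₁ refl
  digits-valid right  = inj₂ (inj₂ refl) , inj₁ refl
  digits-valid left   = inj₂ (inj₁ refl) , inj₁ refl
  digits-valid across = inj₁ refl , inj₂ refl
  digits-valid up     =
    [ (λ a≡1 → inj₂ (inj₁ a≡1)) , (λ a≡-1 → inj₂ (inj₂ a≡-1)) ]′ a≡±1 , inj₂ refl
  digits-valid down   =
    [ (λ a≡1 → inj₂ (inj₂ (cong -_ a≡1))) , (λ a≡-1 → inj₂ (inj₁ (cong -_ a≡-1))) ]′ a≡±1 , inj₂ refl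

  step-of-digits : ∀ {d b} → Digit d → Bit b → ∃ λ σ → δ σ ≡ d × e σ ≡ b
  step-of-digits (inj₁ refl)        (inj₁ refl) = stay , refl , refl
  step-of-digits (inj₂ (inj₁ refl)) (inj₁ refl) = left , refl , refl
  step-of-digits (inj₂ (inj₂ refl)) (inj₁ refl) = right , refl , refl
  step-of-digits (inj₁ refl)        (inj₂ refl) = across , refl , refl
  step-of-digits (inj₂ (inj₁ refl)) (inj₂ refl) =
    [ (λ a≡1 → up , a≡1 , refl) , (λ a≡-1 → down , cong -_ a≡-1 , refl) ]′ a≡±1
  step-of-digits (inj₂ (inj₂ refl)) (inj₂ refl) =
    [ (λ a≡1 → down , cong -_ a≡1 , refl) , (λ a≡-1 → up , a≡-1 , refl) ]′ a≡±1

  digits-injective : ∀ σ σ′ → δ σ ≡ δ σ′ → e σ ≡ e σ′ → σ ≡ σ′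
  digits-injective stay   stay   _  _  = refl
  digits-injective stay   right  () _
  digits-injective stay   left   () _
  digits-injective stay   across _  ()
  digits-injective stay   up     _  ()
  digits-injective stay   down   _  ()
  digits-injective right  stay   () _
  digits-injective right  right  _  _  = refl
  digits-injective right  left   () _
  digits-injective right  across _  ()
  digits-injective right  up     _  ()
  digits-injective right  down   _  ()
  digits-injective left   stay   () _
  digits-injective left   right  () _
  digits-injective left   left   _  _  = refl
  digits-injective left   across _  ()
  digits-injective left   up     _  ()
  digits-injective left   down   _  ()
  digits-injective across stay   _  ()
  digits-injective across right  _  ()
  digits-injective across left   _  ()
  digits-injective across across _  _  = refl
  digits-injective across up     p  _  = ⊥-elim (a≢0 (sym p))
  digits-injective across down   p  _  = ⊥-elim (a≢0 (trans (sym (ℤP.neg-involutive a)) (cong -_ (sym p))))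
  digits-injective up     stay   _  ()
  digits-injective up     right  _  ()
  digits-injective up     left   _  ()
  digits-injective up     across p  _  = ⊥-elim (a≢0 p)
  digits-injective up     up     _  _  = refl
  digits-injective up     down   p  _  = ⊥-elim (a≢-a p)
  digits-injective down   stay   _  ()
  digits-injective down   right  _  ()
  digits-injective down   left   _  ()
  digits-injective down   across p  _  = ⊥-elim (a≢0 (trans (sym (ℤP.neg-involutive a)) (cong -_ p)))
  digits-injective down   up     p  _  = ⊥-elim (a≢-a (sym p))
  digits-injective down   down   _  _  = refl

  Code-step⇒ : ∀ v σ → Code (step v σ) → ∃ λ r → vinv v ∼ s r + δ σ + e σ * M
  Code-step⇒ v σ code with r , p ← Code⇒ code =
    r , ∼-trans (∼-sym (vinv-step-digits m≡2M v σ)) (∼-trans (∼-+-congʳ (δ σ + e σ * M) p)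
          (∼-reflexive (sym (ℤP.+-assoc (s r) (δ σ) (e σ * M)))))

  ⇒Code-step : ∀ v σ r → vinv v ∼ s r + δ σ + e σ * M → Code (step v σ)
  ⇒Code-step v σ r p = ⇒Code (step v σ) r (∼-+-cancelʳ (δ σ + e σ * M)
    (∼-trans (vinv-step-digits m≡2M v σ) (∼-trans p (∼-reflexive (ℤP.+-assoc (s r) (δ σ) (e σ * M))))))

  digits-determined : ∀ v σ σ′ r r′ → vinv v ∼ s r + δ σ + e σ * M → vinv v ∼ s r′ + δ σ′ + e σ′ * M →
                      σ ≡ σ′
  digits-determined v σ σ′ r r′ p p′ = digits-injective σ σ′ (proj₁ (proj₂ same)) (proj₂ (proj₂ same))
    where
    same = tiling-unique r r′ (δ σ) (δ σ′) (e σ) (e σ′) (proj₁ (digits-valid σ)) (proj₁ (digits-valid σ′))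
             (proj₂ (digits-valid σ)) (proj₂ (digits-valid σ′)) (∼-trans (∼-sym p) p′)

  perfect-at : ∀ v r σ → vinv v ∼ s r + δ σ + e σ * M → ∃! _≡_ (λ c → Code c × WithinOne' v c)
  perfect-at v r σ p = step v σ , (⇒Code-step v σ r p , step-withinOne v σ) , unique
    where
    unique-step : ∀ {c} → (∃ λ σ′ → c ≡ step v σ′) → Code c → step v σ ≡ c
    unique-step (σ′ , refl) code = cong (step v) (digits-determined v σ σ′ r (proj₁ r′,p′) p (proj₂ r′,p′))
      where
      r′,p′ = Code-step⇒ v σ′ code
    unique : ∀ {c} → Code c × WithinOne' v c → step v σ ≡ c
    unique {c} (code , within) = unique-step (withinOne⇒step v c within) code

  perfect : IsPerfectCode' Code
  perfect v = from-tiling (tiling-exists (vinv v))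
    where
    from-tiling : (∃ λ r → ∃₂ λ d b → Digit d × Bit b × vinv v ∼ s r + d + b * M) →
                  ∃! _≡_ (λ c → Code c × WithinOne' v c)
    from-tiling (r , d , b , d-digit , b-bit , p) with σ , δσ≡d , eσ≡b ← step-of-digits d-digit b-bit =
      perfect-at v r σ (subst₂ (λ d b → vinv v ∼ s r + d + b * M) (sym δσ≡d) (sym eσ≡b) p)

-- The arithmetic hypotheses

^-monoʳ-∣ : ∀ n {i j} → i ℕ.≤ j → n ^ i ∣ n ^ j
^-monoʳ-∣ n {i} {j} i≤j = subst (λ k → n ^ i ∣ n ^ k) (ℕP.m+[n∸m]≡n i≤j)
  (divides (n ^ (j ℕ.∸ i)) (trans (ℕP.^-distribˡ-+-* n i (j ℕ.∸ i)) (ℕP.*-comm (n ^ i) _)))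

2^k∣m*odd⇒2^k∣m : ∀ k m n → ¬ 2 ∣ n → 2 ^ k ∣ m ℕ.* n → 2 ^ k ∣ m
2^k∣m*odd⇒2^k∣m zero    m n _  _ = ℕD.1∣ m
2^k∣m*odd⇒2^k∣m (suc k) m n 2∤n 2^k+1∣mn with euclidsLemma m n prime[2] (ℕD.m*n∣⇒m∣ 2 (2 ^ k) 2^k+1∣mn)
... | inj₂ 2∣n = ⊥-elim (2∤n 2∣n)
... | inj₁ (divides m′ refl) =
  subst (2 ^ suc k ∣_) (ℕP.*-comm 2 m′) (ℕD.*-monoʳ-∣ 2 (2^k∣m*odd⇒2^k∣m k m′ n 2∤n
    (ℕD.*-cancelˡ-∣ 2 (subst (2 ^ suc k ∣_) (regroup m′ n) 2^k+1∣mn))))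
  where
  regroup : ∀ m′ n → m′ ℕ.* 2 ℕ.* n ≡ 2 ℕ.* (m′ ℕ.* n)
  regroup = NS.solve-∀

∣2n⇒∣n : ∀ k {b n} → b ∣ 2 ℕ.* n → 2 ^ suc k ∣ 2 ℕ.* n → ¬ 2 ^ suc k ∣ b → b ∣ n
∣2n⇒∣n k {b} {n} (divides q 2n≡qb) 2^k+1∣2n 2^k+1∤b with 2 ℕD.∣? q
... | yes (divides q′ refl) = divides q′ (ℕP.*-cancelˡ-≡ n (q′ ℕ.* b) 2 (trans 2n≡qb (regroup q′ b)))
  where
  regroup : ∀ q′ b → q′ ℕ.* 2 ℕ.* b ≡ 2 ℕ.* (q′ ℕ.* b)
  regroup = NS.solve-∀
... | no 2∤q = ⊥-elim (2^k+1∤b (2^k∣m*odd⇒2^k∣m (suc k) b q 2∤q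
                   (subst (2 ^ suc k ∣_) (trans 2n≡qb (ℕP.*-comm q b)) 2^k+1∣2n)))

odd⇒1+2k : ∀ x → ¬ + 2 S.∣ x → ∃ λ k → x ≡ + 1 + k * + 2
odd⇒1+2k x 2∤x with bit-decomposition x
... | _ , k , inj₁ refl , x≡ = ⊥-elim (2∤x (S.divides k (trans x≡ (ℤP.+-identityˡ (k * + 2)))))
... | _ , k , inj₂ refl , x≡ = k , x≡

odd-cofactor : ∀ P z → ¬ P * + 2 S.∣ z * P → ¬ + 2 S.∣ z
odd-cofactor P _ 2P∤zP (S.divides w refl) = 2P∤zP (S.divides w (solve (w ∷ P ∷ [])))

exact-multiples-sum : ∀ P x y → P S.∣ x → ¬ P * + 2 S.∣ x → P S.∣ y → ¬ P * + 2 S.∣ y → P * + 2 S.∣ x + y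
exact-multiples-sum P _ _ (S.divides x′ refl) 2P∤x (S.divides y′ refl) 2P∤y
  with kx , refl ← odd⇒1+2k x′ (odd-cofactor P x′ 2P∤x)
     | ky , refl ← odd⇒1+2k y′ (odd-cofactor P y′ 2P∤y) =
  S.divides (+ 1 + kx + ky) (sum-of-odds kx ky P)
  where
  sum-of-odds : ∀ kx ky P → (+ 1 + kx * + 2) * P + (+ 1 + ky * + 2) * P ≡ (+ 1 + kx + ky) * (P * + 2)
  sum-of-odds = solve-∀

g+yv≡xu⇒g≡xu-yv : ∀ g y v x u → g ℕ.+ y ℕ.* v ≡ x ℕ.* u → + g ≡ + x * + u + (- + y) * + v
g+yv≡xu⇒g≡xu-yv g y v x u eq = begin
  + g                                  ≡⟨ i+j-j≡i (+ g) (+ y * + v) ⟨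
  + g + + y * + v - + y * + v          ≡⟨ cong (_- + y * + v) lifted ⟩
  + x * + u - + y * + v                ≡⟨ cong (λ z → + x * + u + z) (ℤP.neg-distribˡ-* (+ y) (+ v)) ⟩
  + x * + u + (- + y) * + v            ∎
  where
  lifted : + g + + y * + v ≡ + x * + u
  lifted = begin
    + g + + y * + v      ≡⟨ cong (λ z → + g + z) (ℤP.pos-* y v) ⟨
    + g + + (y ℕ.* v)    ≡⟨ ℤP.pos-+ g (y ℕ.* v) ⟨
    + (g ℕ.+ y ℕ.* v)    ≡⟨ cong +_ eq ⟩
    + (x ℕ.* u)          ≡⟨ ℤP.pos-* x u ⟩
    + x * + u            ∎

bézout : ∀ u v → ∃₂ λ X Y → + gcd u v ≡ X * + u + Y * + v
bézout u v with Bézout.identity (gcd-GCD u v)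
... | Bézout.+- x y eq = + x , - + y , g+yv≡xu⇒g≡xu-yv (gcd u v) y v x u eq
... | Bézout.-+ x y eq =
  - + x , + y , trans (g+yv≡xu⇒g≡xu-yv (gcd u v) x u y v eq) (ℤP.+-comm (+ y * + v) ((- + x) * + u))

2∣n∧3∣n⇒6∣n : ∀ {n} → 2 ∣ n → 3 ∣ n → 6 ∣ n
2∣n∧3∣n⇒6∣n 2∣n (divides c refl) with euclidsLemma c 3 prime[2] 2∣n
... | inj₁ (divides c′ refl) = divides c′ (regroup c′)
  where
  regroup : ∀ c′ → c′ ℕ.* 2 ℕ.* 3 ≡ c′ ℕ.* 6
  regroup = NS.solve-∀
... | inj₂ (divides (suc (suc _)) ())

2^k*2≡2^[1+k] : ∀ k → + (2 ^ k) * + 2 ≡ + (2 ^ suc k)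
2^k*2≡2^[1+k] k = trans (sym (ℤP.pos-* (2 ^ k) 2)) (cong +_ (ℕP.*-comm (2 ^ k) 2))

-- For M = (1 + 2μ)P and d = 2P·d″ one has d/2 = d″·M − μ·d, which turns a Bézout relation for 2D
-- into one for D.
halve-combination : ∀ D X Y d″ μ P →
  + 2 * D ≡ X * (d″ * (P * + 2)) + (Y * + 2) * ((+ 1 + μ * + 2) * P) →
  D ≡ (- (X * μ)) * (d″ * (P * + 2)) + (X * d″ + Y) * ((+ 1 + μ * + 2) * P)
halve-combination D X Y d″ μ P 2D≡ = ℤP.*-cancelˡ-≡ (+ 2) D _ (trans 2D≡ (double X Y d″ μ P))
  where
  double : ∀ X Y d″ μ P → X * (d″ * (P * + 2)) + (Y * + 2) * ((+ 1 + μ * + 2) * P)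
                          ≡ + 2 * ((- (X * μ)) * (d″ * (P * + 2)) + (X * d″ + Y) * ((+ 1 + μ * + 2) * P))
  double = solve-∀

α-1-odd : ∀ n → ¬ 2 ∣ n → α-1 n ≡ 0
α-1-odd zero          2∤n = ⊥-elim (2∤n (2 ℕD.∣0))
α-1-odd (suc zero)    _   = refl
α-1-odd (suc (suc n)) 2∤n = α-1-odd n (λ 2∣n → 2∤n (ℕD.∣m∣n⇒∣m+n (ℕD.∣-refl {2}) 2∣n))

α-1-even : ∀ n → 2 ∣ n → α-1 n ≡ 1
α-1-even zero          _   = refl
α-1-even (suc zero)    (divides (suc _) ())
α-1-even (suc (suc n)) 2∣n = α-1-even n (ℕD.∣m+n∣m⇒∣n 2∣n (ℕD.∣-refl {2}))

IsSigma-fin⇒∤ : ∀ z {i} → IsSigma z (fin i) → ¬ 2 ^ suc i ∣ ∣ z ∣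
IsSigma-fin⇒∤ _ {i} (_ , maximal) 2^i+1∣z = ℕP.<-irrefl refl (maximal (suc i) 2^i+1∣z)

IsSigma-≥⇒∣ : ∀ z {σ k} → IsSigma z σ → fin k ≤∞ σ → 2 ^ k ∣ ∣ z ∣
IsSigma-≥⇒∣ _ {fin _} (2^i∣z , _) (fin≤fin k≤i) = ℕD.∣-trans (^-monoʳ-∣ 2 k≤i) 2^i∣z
IsSigma-≥⇒∣ _ {∞}     refl          ≤∞-top       = _ ℕD.∣0

IsSigma≢0⇒2∣ : ∀ {z σ} → z ≢ + 0 → IsSigma z σ → σ ≢ fin 0 → 2 ∣ ∣ z ∣
IsSigma≢0⇒2∣ {σ = ∞}           z≢0 z≡0 _   = ⊥-elim (z≢0 z≡0)
IsSigma≢0⇒2∣ {σ = fin zero}    _   _   σ≢0 = ⊥-elim (σ≢0 refl)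
IsSigma≢0⇒2∣ {σ = fin (suc u)} _   (2^u+1∣z , _) _ = ℕD.m*n∣⇒m∣ 2 (2 ^ u) 2^u+1∣z

∣∣-coefficient : ∀ X z → ∃ λ X′ → X * + ∣ z ∣ ≡ X′ * z
∣∣-coefficient X z with ℤP.+∣i∣≡i⊎+∣i∣≡-i z
... | inj₁ ∣z∣≡z  = X , cong (X *_) ∣z∣≡z
... | inj₂ ∣z∣≡-z =
  - X , trans (cong (X *_) ∣z∣≡-z) (trans (sym (ℤP.neg-distribʳ-* X z)) (ℤP.neg-distribˡ-* X z))

g-in-terms-of-d : ∀ a l h M → a * a ≡ + 1 → a * l - h + l * M ≡ a * (l - a * h) + l * M
g-in-terms-of-d a l h M a²≡1 = begin
  a * l - h + l * M              ≡⟨ cong (λ u → a * l - u + l * M) (ℤP.*-identityˡ h) ⟨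
  a * l - + 1 * h + l * M        ≡⟨ cong (λ u → a * l - u * h + l * M) a²≡1 ⟨
  a * l - a * a * h + l * M      ≡⟨ solve (a ∷ l ∷ h ∷ M ∷ []) ⟩
  a * (l - a * h) + l * M        ∎

d-combination⇒g-combination : ∀ X Y a d l M → a * a ≡ + 1 →
                              X * d + Y * M ≡ (X * a) * (a * d + l * M) + (Y - X * a * l) * M
d-combination⇒g-combination X Y a d l M a²≡1 = begin
  X * d + Y * M                                   ≡⟨ cong (λ u → X * u + Y * M) (ℤP.*-identityˡ d) ⟨
  X * (+ 1 * d) + Y * M                           ≡⟨ cong (λ u → X * (u * d) + Y * M) a²≡1 ⟨
  X * (a * a * d) + Y * M                         ≡⟨ solve (X ∷ Y ∷ a ∷ d ∷ l ∷ M ∷ []) ⟩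
  (X * a) * (a * d + l * M) + (Y - X * a * l) * M ∎

module Conditions (m l h : ℕ) .{{_ : NonZero m}} .{{_ : NonZero l}} (a : ℤ) (a≡±1 : a ≡ + 1 ⊎ a ≡ - + 1)
                  (6∣m : 6 ∣ m) (3∣d : + 3 ℤD.∣ (+ l - a * + h)) where

  M : ℕ
  M = m / 2

  d : ℤ
  d = + l - a * + h

  g : ℤ
  g = a * + l - + h + + l * + M

  b : ℕ
  b = gcd ∣ d ∣ m

  a²≡1 : a * a ≡ + 1
  a²≡1 = [ (λ a≡1 → cong₂ _*_ a≡1 a≡1) , (λ a≡-1 → cong₂ _*_ a≡-1 a≡-1) ]′ a≡±1

  g≡ad+lM : g ≡ a * d + + l * + M
  g≡ad+lM = g-in-terms-of-d a (+ l) (+ h) (+ M) a²≡1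

  m≡2M : m ≡ 2 ℕ.* M
  m≡2M = sym (m*[n/m]≡n (ℕD.∣-trans (divides 3 refl) 6∣m))

  +m≡2M : + m ≡ + 2 * + M
  +m≡2M = trans (cong +_ m≡2M) (ℤP.pos-* 2 M)

  conditions : ∀ R D → 3 ℕ.* R ≡ D → D ≢ 0 → D ∣ ∣ d ∣ → D ∣ M → (∃₂ λ X Y → + D ≡ X * d + Y * + M) →
               ∀ P → P S.∣ g → P S.∣ + m → ¬ P S.∣ + M →
               TilingConditions g (+ M) (+ m) R
  conditions R _ refl D≢0 D∣d D∣M (X , Y , D≡Xd+YM) P P∣g P∣m P∤M = record
    { R≢0     = ℕ.≢-nonZero (λ R≡0 → D≢0 (cong (3 ℕ.*_) R≡0))
    ; D∣g     = subst (_ S.∣_) (sym g≡ad+lM)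
                  (S.∣m∣n⇒∣m+n (S.∣n⇒∣m*n a (S.∣ᵤ⇒∣ D∣d)) (S.∣n⇒∣m*n (+ l) (S.∣ᵤ⇒∣ D∣M)))
    ; D∣M     = S.∣ᵤ⇒∣ D∣M
    ; x       = X * a
    ; y       = Y - X * a * + l
    ; D≡xg+yM = trans D≡Xd+YM (trans (d-combination⇒g-combination X Y a d (+ l) (+ M) a²≡1)
                  (cong (λ u → (X * a) * u + (Y - X * a * + l) * + M) (sym g≡ad+lM)))
    ; M∉L     = λ { (k , q , M≡) → P∤M (subst (P S.∣_) (sym M≡)
                  (S.∣m∣n⇒∣m+n (S.∣n⇒∣m*n k P∣g) (S.∣n⇒∣m*n q P∣m))) }
    }

  b≢0 : b ≢ 0
  b≢0 = gcd[m,n]≢0 ∣ d ∣ m (inj₂ (ℕ.≢-nonZero⁻¹ m))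

  b∣d : b ∣ ∣ d ∣
  b∣d = gcd[m,n]∣m ∣ d ∣ m

  b∣2M : b ∣ 2 ℕ.* M
  b∣2M = subst (b ∣_) m≡2M (gcd[m,n]∣n ∣ d ∣ m)

  3∣b : 3 ∣ b
  3∣b = gcd-greatest 3∣d (ℕD.∣-trans (divides 2 refl) 6∣m)

  b-bézout : ∃₂ λ X Y → + b ≡ X * d + (Y * + 2) * + M
  b-bézout with X , Y , b≡ ← bézout ∣ d ∣ m with X′ , X∣d∣≡X′d ← ∣∣-coefficient X d =
    X′ , Y , trans b≡ (cong₂ _+_ X∣d∣≡X′d (trans (cong (Y *_) +m≡2M) (sym (ℤP.*-assoc Y (+ 2) (+ M)))))

  2^k∣M : ∀ k → 2 ^ suc k ∣ m → 2 ^ k ∣ M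
  2^k∣M k 2^k+1∣m = ℕD.*-cancelˡ-∣ 2 (subst (2 ^ suc k ∣_) m≡2M 2^k+1∣m)

  2^k+1∤M : ∀ k → ¬ 2 ^ suc (suc k) ∣ m → ¬ 2 ^ suc k ∣ M
  2^k+1∤M k 2^k+2∤m 2^k+1∣M = 2^k+2∤m (subst (2 ^ suc (suc k) ∣_) (sym m≡2M) (ℕD.*-monoʳ-∣ 2 2^k+1∣M))

  M-odd-part : ∀ k → 2 ^ suc k ∣ m → ¬ 2 ^ suc (suc k) ∣ m → ∃ λ μ → + M ≡ (+ 1 + μ * + 2) * + (2 ^ k)
  M-odd-part k 2^k+1∣m 2^k+2∤m =
    proj₁ M′≡1+2μ , trans (cong +_ M≡M′2^k) (trans (ℤP.pos-* M′ (2 ^ k)) (cong (_* + (2 ^ k)) (proj₂ M′≡1+2μ)))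
    where
    M′ = ℕD.quotient (2^k∣M k 2^k+1∣m)
    M≡M′2^k : M ≡ M′ ℕ.* 2 ^ k
    M≡M′2^k = ℕD.m∣n⇒n≡quotient*m (2^k∣M k 2^k+1∣m)
    M′-odd : ¬ + 2 S.∣ + M′
    M′-odd 2∣M′ = 2^k+1∤M k 2^k+2∤m (subst (2 ^ suc k ∣_) (sym M≡M′2^k) (ℕD.*-monoˡ-∣ (2 ^ k) (S.∣⇒∣ᵤ 2∣M′)))
    M′≡1+2μ = odd⇒1+2k (+ M′) M′-odd

  even-l⇒∣lM : ∀ {k} → 2 ∣ l → k ∣ m → k ∣ l ℕ.* M
  even-l⇒∣lM {k} 2∣l k∣m = subst (k ∣_) l′m≡lM (ℕD.∣n⇒∣m*n l′ k∣m)
    where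
    l′ = ℕD.quotient 2∣l
    l′m≡lM : l′ ℕ.* m ≡ l ℕ.* M
    l′m≡lM = trans (cong (l′ ℕ.*_) m≡2M)
               (trans (sym (ℕP.*-assoc l′ 2 M)) (cong (ℕ._* M) (sym (ℕD.m∣n⇒n≡quotient*m 2∣l))))

  caseA : ∀ v → ¬ 2 ∣ l → 2 ^ suc v ∣ m → ¬ 2 ^ suc (suc v) ∣ m → 2 ^ v ∣ ∣ d ∣ → ¬ 2 ^ suc v ∣ ∣ d ∣ →
          TilingConditions g (+ M) (+ m) (b / 3)
  caseA v 2∤l 2^v+1∣m 2^v+2∤m 2^v∣d 2^v+1∤d =
    conditions (b / 3) b (m*[n/m]≡n 3∣b) b≢0 b∣d b∣M
               (proj₁ b-bézout , proj₁ (proj₂ b-bézout) * + 2 , proj₂ (proj₂ b-bézout))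
               P P∣g (S.∣ᵤ⇒∣ 2^v+1∣m) (λ P∣M → 2^k+1∤M v 2^v+2∤m (S.∣⇒∣ᵤ P∣M))
    where
    b∣M : b ∣ M
    b∣M = ∣2n⇒∣n v b∣2M (subst (2 ^ suc v ∣_) m≡2M 2^v+1∣m) (λ 2^v+1∣b → 2^v+1∤d (ℕD.∣-trans 2^v+1∣b b∣d))
    P : ℤ
    P = + (2 ^ suc v)
    Q : ℤ
    Q = + (2 ^ v)
    Q*2∤ad : ¬ Q * + 2 S.∣ a * d
    Q*2∤ad Q*2∣ad = 2^v+1∤d (S.∣⇒∣ᵤ (subst₂ S._∣_ (2^k*2≡2^[1+k] v) a[ad]≡d (S.∣n⇒∣m*n a Q*2∣ad)))
      where
      a[ad]≡d : a * (a * d) ≡ d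
      a[ad]≡d = trans (sym (ℤP.*-assoc a a d)) (trans (cong (_* d) a²≡1) (ℤP.*-identityˡ d))
    Q*2∤lM : ¬ Q * + 2 S.∣ + l * + M
    Q*2∤lM Q*2∣lM = 2^k+1∤M v 2^v+2∤m (2^k∣m*odd⇒2^k∣m (suc v) M l 2∤l (subst (2 ^ suc v ∣_) (ℕP.*-comm l M)
      (S.∣⇒∣ᵤ (subst₂ S._∣_ (2^k*2≡2^[1+k] v) (sym (ℤP.pos-* l M)) Q*2∣lM))))
    P∣g : P S.∣ g
    P∣g = subst₂ S._∣_ (2^k*2≡2^[1+k] v) (sym g≡ad+lM)
            (exact-multiples-sum Q (a * d) (+ l * + M) (S.∣n⇒∣m*n a (S.∣ᵤ⇒∣ 2^v∣d)) Q*2∤ad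
               (S.∣n⇒∣m*n (+ l) (S.∣ᵤ⇒∣ (2^k∣M v 2^v+1∣m))) Q*2∤lM)

  caseB : ∀ s → 2 ∣ l → 2 ^ suc s ∣ m → ¬ 2 ^ suc (suc s) ∣ m → 2 ^ suc s ∣ ∣ d ∣ →
          TilingConditions g (+ M) (+ m) (b / 6)
  caseB s 2∣l 2^s+1∣m 2^s+2∤m 2^s+1∣d
    with S.divides d″ d≡d″P ← S.∣ᵤ⇒∣ {+ (2 ^ suc s)} {d} 2^s+1∣d
       | μ , M≡ ← M-odd-part s 2^s+1∣m 2^s+2∤m =
    conditions (b / 6) D refl D≢0 D∣d D∣M (- (X * μ) , X * d″ + Y , D≡) P P∣g (S.∣ᵤ⇒∣ 2^s+1∣m)
               (λ P∣M → 2^k+1∤M s 2^s+2∤m (S.∣⇒∣ᵤ P∣M))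
    where
    D = 3 ℕ.* (b / 6)
    b≡2D : b ≡ 2 ℕ.* D
    b≡2D = trans (sym (m*[n/m]≡n (2∣n∧3∣n⇒6∣n (ℕD.m*n∣⇒m∣ 2 (2 ^ s) (gcd-greatest 2^s+1∣d 2^s+1∣m)) 3∣b)))
                 (ℕP.*-assoc 2 3 (b / 6))
    D≢0 : D ≢ 0
    D≢0 D≡0 = b≢0 (trans b≡2D (cong (2 ℕ.*_) D≡0))
    D∣d : D ∣ ∣ d ∣
    D∣d = ℕD.m*n∣⇒n∣ 2 D (subst (_∣ ∣ d ∣) b≡2D b∣d)
    D∣M : D ∣ M
    D∣M = ℕD.*-cancelˡ-∣ 2 (subst (_∣ 2 ℕ.* M) b≡2D b∣2M)
    P : ℤ
    P = + (2 ^ suc s)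
    Q : ℤ
    Q = + (2 ^ s)
    d≡ : d ≡ d″ * (Q * + 2)
    d≡ = trans d≡d″P (cong (d″ *_) (sym (2^k*2≡2^[1+k] s)))
    X = proj₁ b-bézout
    Y = proj₁ (proj₂ b-bézout)
    D≡ : + D ≡ (- (X * μ)) * d + (X * d″ + Y) * + M
    D≡ = subst₂ (λ u v → + D ≡ (- (X * μ)) * u + (X * d″ + Y) * v) (sym d≡) (sym M≡)
           (halve-combination (+ D) X Y d″ μ Q (begin
             + 2 * + D                                              ≡⟨ ℤP.pos-* 2 D ⟨
             + (2 ℕ.* D)                                            ≡⟨ cong +_ b≡2D ⟨
             + b                                                    ≡⟨ proj₂ (proj₂ b-bézout) ⟩
             X * d + (Y * + 2) * + M                                ≡⟨ cong₂ (λ u v → X * u + (Y * + 2) * v) d≡ M≡ ⟩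
             X * (d″ * (Q * + 2)) + (Y * + 2) * ((+ 1 + μ * + 2) * Q) ∎))
    P∣g : P S.∣ g
    P∣g = subst (P S.∣_) (sym g≡ad+lM) (S.∣m∣n⇒∣m+n (S.∣n⇒∣m*n a (S.∣ᵤ⇒∣ 2^s+1∣d))
            (subst (P S.∣_) (ℤP.pos-* l M) (S.∣ᵤ⇒∣ (even-l⇒∣lM 2∣l 2^s+1∣m))))

  m≢0 : + m ≢ + 0
  m≢0 m≡0 = ℕ.≢-nonZero⁻¹ m (ℤP.+-injective m≡0)

  odd-case : ∀ {σm σl σd} → IsSigma (+ m) σm → IsSigma (+ l) σl → IsSigma d σd →
             σl ≡ fin 0 → σm ≡ suc∞ σd → TilingConditions g (+ M) (+ m) (b / (3 ℕ.* α l))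
  odd-case {σd = ∞}     m≡0 _  _  _    refl = ⊥-elim (m≢0 m≡0)
  odd-case {σd = fin v} Sm  Sl Sd refl refl =
    subst (λ k → TilingConditions g (+ M) (+ m) (b / (3 ℕ.* suc k))) (sym (α-1-odd l 2∤l))
      (caseA v 2∤l (proj₁ Sm) (IsSigma-fin⇒∤ (+ m) Sm) (proj₁ Sd) (IsSigma-fin⇒∤ d Sd))
    where
    2∤l : ¬ 2 ∣ l
    2∤l = IsSigma-fin⇒∤ (+ l) Sl

  even-case : ∀ {σm σl σd} → IsSigma (+ m) σm → IsSigma (+ l) σl → IsSigma d σd →
              σl ≢ fin 0 → σm ≤∞ σd → TilingConditions g (+ M) (+ m) (b / (3 ℕ.* α l))
  even-case {σm = ∞}           m≡0 _  _  _    _  = ⊥-elim (m≢0 m≡0)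
  even-case {σm = fin zero}    Sm  _  _  _    _  =
    ⊥-elim (IsSigma-fin⇒∤ (+ m) Sm (divides M (trans m≡2M (ℕP.*-comm 2 M))))
  even-case {σm = fin (suc s)} Sm  Sl Sd σl≢0 σm≤σd =
    subst (λ k → TilingConditions g (+ M) (+ m) (b / (3 ℕ.* suc k))) (sym (α-1-even l 2∣l))
      (caseB s 2∣l (proj₁ Sm) (IsSigma-fin⇒∤ (+ m) Sm) (IsSigma-≥⇒∣ d Sd σm≤σd))
    where
    2∣l : 2 ∣ l
    2∣l = IsSigma≢0⇒2∣ (λ l≡0 → ℕ.≢-nonZero⁻¹ l (ℤP.+-injective l≡0)) Sl σl≢0

  tiling-conditions : ∀ {σm σl σd} → IsSigma (+ m) σm → IsSigma (+ l) σl → IsSigma d σd →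
                      (σl ≡ fin 0 × σm ≡ suc∞ σd) ⊎ (σl ≢ fin 0 × σm ≤∞ σd) →
                      TilingConditions g (+ M) (+ m) (b / (3 ℕ.* α l))
  tiling-conditions Sm Sl Sd (inj₁ (σl≡0 , σm≡σd+1)) = odd-case Sm Sl Sd σl≡0 σm≡σd+1
  tiling-conditions Sm Sl Sd (inj₂ (σl≢0 , σm≤σd))   = even-case Sm Sl Sd σl≢0 σm≤σd

proposition2p6 : (m l h : ℕ) .{{_ : NonZero m}} .{{_ : NonZero l}} →
    h < m → 0 < l → 6 ∣ m →
    (a : ℤ) → (a ≡ + 1 ⊎ a ≡ - + 1) → + 3 ℤD.∣ (+ l - a * + h) →
    (σm σl σh σd : ℕ∞) →
    IsSigma (+ m) σm → IsSigma (+ l) σl → IsSigma (+ h) σh → IsSigma (+ l - a * + h) σd →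
    ((σl ≡ fin 0 × σm ≡ suc∞ σd) ⊎ (σh ≢ fin 0 × σl ≢ fin 0 × σm ≤∞ σd)) →
    (t : Fin (gcd ∣ + l - a * + h ∣ m / (3 ℕ.* α l)) → Fin 2) →
    Graph.IsPerfectCode' m l h
      (λ u → ∃ λ r → ∃ λ (j : ℤ) →
        u ≡ Graph.ψ m l h (+ 3 * + toℕ r + a * j + (j + + toℕ (t r)) * + (m / 2)) j)
proposition2p6 m l h _ _ 6∣m a a≡±1 3∣d _ _ _ _ Sm Sl _ Sd σ-cases t =
  PerfectCode.perfect m l h a a≡±1 +m≡2M (tiling-conditions Sm Sl Sd (Sum.map₂ proj₂ σ-cases))
                      (λ r → + toℕ (t r))
  where
  open Conditions m l h a a≡±1 6∣m 3∣d
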